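{- For a read-once Boolean function $f$ the following are equivalent: (1) $f$ is linear read-once; (2) $f$ is a Chow function; (3) no restriction of $f$ coincides, up to renaming of variables, with $g_1(x,y,z,u)=(x\vee y)\wedge(z\vee u)$, with $g_2(x,y,z,u)=(x\wedge y)\vee(z\wedge u)$, or with any function obtained from $g_1$ or $g_2$ by negating some of the variables.
   Context: A Boolean function is read-once if it can be represented by a formula over conjunction, disjunction and negation in which each variable appears at most once. It is linear read-once (lro) if it is constant or representable by a nested formula: the literals $x,\overline{x}$ are nested formulas, and if $t$ is a nested formula not containing $x$ or $\overline{x}$ then $x\vee t$, $x\wedge t$, $\overline{x}\vee t$, $\overline{x}\wedge t$ are nested formulas. The Chow parameters of $f(x_1,\ldots,x_n)$ are $(w_1(f),\ldots,w_n(f),w(f))$, where $w(f)$ is the number of true points of $f$ and $w_i(f)$ is the number of true points with $x_i=1$; $f$ is a Chow function if no other Boolean function of $x_1,\dots,x_n$ has the same Chow parameters. A restriction of $f$ is a function obtained by fixing some variables $x_{i_1}=\alpha_1,\ldots,x_{i_k}=\alpha_k$ with $\alpha_j\in\{0,1\}$. -}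

module Defs where

open import Data.Nat using (ℕ; zero; suc)
open import Data.Bool using (Bool; true; false; _∧_; _∨_; not; _xor_)
open import Data.Fin using (Fin)
open import Data.Vec using (Vec; []; _∷_; lookup; _[_]≔_)
open import Data.List using (List; []; _∷_; _++_; map; length; filter)
open import Data.List.Membership.Propositional using (_∉_)
open import Data.List.Relation.Unary.Unique.Propositional using (Unique)
open import Data.Product using (Σ; ∃; _×_; _,_)
open import Data.Sum using (_⊎_)
open import Relation.Binary.PropositionalEquality using (_≡_; _≢_)
open import Relation.Nullary using (¬_)
open import Relation.Nullary.Decidable using (does)
open import Data.Bool.Properties using (T?)

BoolFun : ℕ → Set
BoolFun n = Vec Bool n → Bool

_≗f_ : ∀ {n} → BoolFun n → BoolFun n → Set
f ≗f g = ∀ x → f x ≡ g x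

data Formula (n : ℕ) : Set where
  const : Bool → Formula n
  var   : Fin n → Formula n
  neg   : Formula n → Formula n
  and   : Formula n → Formula n → Formula n
  or    : Formula n → Formula n → Formula n

⟦_⟧ : ∀ {n} → Formula n → BoolFun n
⟦ const b ⟧ x = b
⟦ var i ⟧ x = lookup x i
⟦ neg φ ⟧ x = not (⟦ φ ⟧ x)
⟦ and φ ψ ⟧ x = ⟦ φ ⟧ x ∧ ⟦ ψ ⟧ x
⟦ or φ ψ ⟧ x = ⟦ φ ⟧ x ∨ ⟦ ψ ⟧ x

vars : ∀ {n} → Formula n → List (Fin n)
vars (const b) = []
vars (var i) = i ∷ []
vars (neg φ) = vars φ
vars (and φ ψ) = vars φ ++ vars ψ
vars (or φ ψ) = vars φ ++ vars ψ

ReadOnceFormula : ∀ {n} → Formula n → Set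
ReadOnceFormula φ = Unique (vars φ)

ReadOnce : ∀ {n} → BoolFun n → Set
ReadOnce {n} f = Σ (Formula n) λ φ → ReadOnceFormula φ × (⟦ φ ⟧ ≗f f)

data Nested {n : ℕ} : Formula n → Set where
  pos    : (i : Fin n) → Nested (var i)
  negl   : (i : Fin n) → Nested (neg (var i))
  or-pos  : (i : Fin n) {t : Formula n} → Nested t → i ∉ vars t → Nested (or (var i) t)
  and-pos : (i : Fin n) {t : Formula n} → Nested t → i ∉ vars t → Nested (and (var i) t)
  or-neg  : (i : Fin n) {t : Formula n} → Nested t → i ∉ vars t → Nested (or (neg (var i)) t)
  and-neg : (i : Fin n) {t : Formula n} → Nested t → i ∉ vars t → Nested (and (neg (var i)) t)

Constant : ∀ {n} → BoolFun n → Set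
Constant f = ∃ λ b → ∀ x → f x ≡ b

LinearReadOnce : ∀ {n} → BoolFun n → Set
LinearReadOnce {n} f = Constant f ⊎ Σ (Formula n) λ φ → Nested φ × (⟦ φ ⟧ ≗f f)

allPoints : (n : ℕ) → List (Vec Bool n)
allPoints zero = [] ∷ []
allPoints (suc n) = map (false ∷_) (allPoints n) ++ map (true ∷_) (allPoints n)

countTrue : ∀ {n} → (Vec Bool n → Bool) → ℕ
countTrue {n} p = length (filter (λ x → T? (p x)) (allPoints n))

w : ∀ {n} → BoolFun n → ℕ
w f = countTrue f

wᵢ : ∀ {n} → BoolFun n → Fin n → ℕ
wᵢ f i = countTrue (λ x → lookup x i ∧ f x)

ChowParams : ∀ {n} → BoolFun n → Vec ℕ n × ℕ
ChowParams {n} f = Data.Vec.tabulate (wᵢ f) , w f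

Chow : ∀ {n} → BoolFun n → Set
Chow {n} f = (g : BoolFun n) → ChowParams g ≡ ChowParams f → g ≗f f

g₁ g₂ : Bool → Bool → Bool → Bool → Bool
g₁ x y z u = (x ∨ y) ∧ (z ∨ u)
g₂ x y z u = (x ∧ y) ∨ (z ∧ u)

RestrictsTo : ∀ {n} → BoolFun n → (Bool → Bool → Bool → Bool → Bool) → Set
RestrictsTo {n} f g =
  Σ (Fin n) λ a → Σ (Fin n) λ b → Σ (Fin n) λ c → Σ (Fin n) λ d →
  (a ≢ b × a ≢ c × a ≢ d × b ≢ c × b ≢ d × c ≢ d) ×
  Σ (Vec Bool n) λ α →
  Σ Bool λ s₁ → Σ Bool λ s₂ → Σ Bool λ s₃ → Σ Bool λ s₄ →
  ∀ x y z u →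
    f ((((α [ a ]≔ x) [ b ]≔ y) [ c ]≔ z) [ d ]≔ u)
      ≡ g (x xor s₁) (y xor s₂) (z xor s₃) (u xor s₄)

NoForbiddenRestriction : ∀ {n} → BoolFun n → Set
NoForbiddenRestriction f = ¬ RestrictsTo f g₁ × ¬ RestrictsTo f g₂

-- The Chow parameters of f determine its moments ∑ 𝟙 (f y) * L y against every affine form L,
-- and conversely.
--
-- A nested formula is a threshold function: adding its literals from the inside out, each with
-- a weight exceeding the range of the form built so far, gives an affine L whose sign is f.  If
-- g has the Chow parameters of f then ∑ (𝟙 f - 𝟙 g) * L = 0 with nonnegative summands, so g = f.
--
-- Restrictions of Chow functions are Chow: change f only on the subcube, using that an affine
-- form stays affine there.  Every variant of g₁ (inputs and output possibly negated, which also
-- covers g₂) has a twin built from h₁ = (x ∨ z) ∧ (y ∨ u) with the same Chow parameters.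
--
-- Conversely, by induction on a read-once formula every subformula is constant, nested, or has
-- a forbidden restriction.  A conjunction of nested formulas on disjoint variables is re-nested
-- by pulling conjoined literals to the front, unless both have the form ℓ ∨ t; fixing each t to
-- a literal then exhibits g₁.  Forbidden restrictions survive conjunction with a satisfiable
-- function on other variables because every variable of g₁ is essential, and disjunctions
-- reduce to conjunctions by De Morgan.

module Submission where

open import Defs
open import Data.Bool using (Bool; true; false; not; _∧_; _∨_; _xor_; if_then_else_)
import Data.Bool.Properties as Boolₚ
open import Data.Empty using (⊥-elim)
open import Data.Fin as Fin using (Fin)
import Data.Fin.Properties as Finₚ
open import Data.Integer as ℤ using (ℤ; +_; +0; -[1+_]; _+_; _*_; -_; _-_; _≤_; +≤+; -≤+)
import Data.Integer.Properties as ℤₚ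
open import Data.Integer.Tactic.RingSolver using (solve-∀)
open import Data.List as List using (List; []; _∷_; _++_; length; filter)
import Data.List.Properties as Listₚ
open import Data.List.Membership.Propositional using (_∈_; _∉_)
open import Data.List.Membership.Propositional.Properties using (∈-++⁺ˡ; ∈-++⁺ʳ; ∈-++⁻)
open import Data.List.Relation.Binary.Disjoint.Propositional using (Disjoint)
import Data.List.Relation.Binary.Disjoint.Propositional.Properties as Disjointₚ
import Data.List.Relation.Binary.Permutation.Propositional.Properties as ↭ₚ
open import Data.List.Relation.Binary.Subset.Propositional using (_⊆_)
import Data.List.Relation.Binary.Subset.Propositional.Properties as ⊆ₚ
import Data.List.Relation.Unary.All as Allₗ
import Data.List.Relation.Unary.All.Properties as Allₗₚ
open import Data.List.Relation.Unary.AllPairs using ([]; _∷_)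
import Data.List.Relation.Unary.Any as Anyₗ
open import Data.List.Relation.Unary.Any using (here; there)
open import Data.List.Relation.Unary.Unique.Propositional using (Unique)
open import Data.Nat as ℕ using (ℕ; zero; suc; z≤n)
import Data.Nat.Properties as ℕₚ
open import Data.Product using (_×_; Σ; ∃; _,_; proj₁; proj₂)
import Data.Product.Properties as Productₚ
open import Data.Sum using (_⊎_; inj₁; inj₂; [_,_]′)
open import Data.Vec as Vec using (Vec; []; _∷_; lookup; tabulate; _[_]≔_)
import Data.Vec.Properties as Vecₚ
open import Data.Vec.Membership.Propositional using () renaming (_∈_ to _∈ᵥ_; _∉_ to _∉ᵥ_)
open import Data.Vec.Relation.Unary.All using ([]; _∷_)
import Data.Vec.Relation.Unary.All as Allᵥ
open import Data.Vec.Relation.Unary.AllPairs using ([]; _∷_)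
import Data.Vec.Relation.Unary.Any as Anyᵥ
import Data.Vec.Relation.Unary.Any.Properties as Anyᵥₚ
open import Data.Vec.Relation.Unary.Unique.Propositional using () renaming (Unique to Uniqueᵥ)
open import Function using (_∘_)
open import Function.Bundles using (_⇔_; mk⇔)
open import Relation.Binary.PropositionalEquality
open import Relation.Nullary using (¬_; ¬?; Dec; yes; no; does)
open import Relation.Nullary.Decidable using (dec-true; dec-false; from-yes)

-- Sums over the Boolean cube

𝟙 : Bool → ℤ
𝟙 true  = + 1
𝟙 false = +0

∑ : ∀ {n} → (Vec Bool n → ℤ) → ℤ
∑ {zero}  h = h []
∑ {suc n} h = ∑ (h ∘ (false ∷_)) + ∑ (h ∘ (true ∷_))

∑-cong : ∀ {n} {h k : Vec Bool n → ℤ} → (∀ y → h y ≡ k y) → ∑ h ≡ ∑ k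
∑-cong {zero}  e = e []
∑-cong {suc n} e = cong₂ _+_ (∑-cong (e ∘ (false ∷_))) (∑-cong (e ∘ (true ∷_)))

∑-+ : ∀ {n} (h k : Vec Bool n → ℤ) → ∑ (λ y → h y + k y) ≡ ∑ h + ∑ k
∑-+ {zero}  h k = refl
∑-+ {suc n} h k =
  trans (cong₂ _+_ (∑-+ (h ∘ (false ∷_)) (k ∘ (false ∷_))) (∑-+ (h ∘ (true ∷_)) (k ∘ (true ∷_))))
        (interchange (∑ (h ∘ (false ∷_))) (∑ (k ∘ (false ∷_))) (∑ (h ∘ (true ∷_))) (∑ (k ∘ (true ∷_))))
  where
  interchange : ∀ a b c d → (a + b) + (c + d) ≡ (a + c) + (b + d)
  interchange = solve-∀

∑-- : ∀ {n} (h k : Vec Bool n → ℤ) → ∑ (λ y → h y - k y) ≡ ∑ h - ∑ k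
∑-- {zero}  h k = refl
∑-- {suc n} h k =
  trans (cong₂ _+_ (∑-- (h ∘ (false ∷_)) (k ∘ (false ∷_))) (∑-- (h ∘ (true ∷_)) (k ∘ (true ∷_))))
        (interchange (∑ (h ∘ (false ∷_))) (∑ (k ∘ (false ∷_))) (∑ (h ∘ (true ∷_))) (∑ (k ∘ (true ∷_))))
  where
  interchange : ∀ a b c d → (a - b) + (c - d) ≡ (a + c) - (b + d)
  interchange = solve-∀

∑-*ˡ : ∀ {n} c (h : Vec Bool n → ℤ) → ∑ (λ y → c * h y) ≡ c * ∑ h
∑-*ˡ {zero}  c h = refl
∑-*ˡ {suc n} c h =
  trans (cong₂ _+_ (∑-*ˡ c (h ∘ (false ∷_))) (∑-*ˡ c (h ∘ (true ∷_)))) (sym (ℤₚ.*-distribˡ-+ c _ _))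

∑-zero : ∀ {n} → ∑ {n} (λ _ → +0) ≡ +0
∑-zero {zero}  = refl
∑-zero {suc n} = cong₂ _+_ (∑-zero {n}) (∑-zero {n})

∑-nonneg : ∀ {n} {h : Vec Bool n → ℤ} → (∀ y → +0 ≤ h y) → +0 ≤ ∑ h
∑-nonneg {zero}  p = p []
∑-nonneg {suc n} p = ℤₚ.+-mono-≤ (∑-nonneg (p ∘ (false ∷_))) (∑-nonneg (p ∘ (true ∷_)))

∑-nonneg-zero : ∀ {n} {h : Vec Bool n → ℤ} → (∀ y → +0 ≤ h y) → ∑ h ≡ +0 → ∀ y → h y ≡ +0
∑-nonneg-zero {zero}  p e [] = e
∑-nonneg-zero {suc n} {h} p e (b ∷ y) = ∑-nonneg-zero (p ∘ (b ∷_)) (half b) y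
  where
  summand-zero : ∀ {a c} → +0 ≤ a → +0 ≤ c → a + c ≡ +0 → a ≡ +0
  summand-zero {a} {c} 0≤a 0≤c a+c≡0 =
    ℤₚ.≤-antisym (subst (a ≤_) a+c≡0 (ℤₚ.i≤i+j a c {{ℤ.nonNegative 0≤c}})) 0≤a
  0≤false : +0 ≤ ∑ (h ∘ (false ∷_))
  0≤false = ∑-nonneg (p ∘ (false ∷_))
  0≤true : +0 ≤ ∑ (h ∘ (true ∷_))
  0≤true = ∑-nonneg (p ∘ (true ∷_))
  half : ∀ b → ∑ (h ∘ (b ∷_)) ≡ +0
  half false = summand-zero 0≤false 0≤true e
  half true  = summand-zero 0≤true 0≤false (trans (ℤₚ.+-comm (∑ (h ∘ (true ∷_))) (∑ (h ∘ (false ∷_)))) e)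

∑-swap : ∀ {m n} (T : Vec Bool m → Vec Bool n → ℤ) →
         ∑ (λ y → ∑ (T y)) ≡ ∑ (λ v → ∑ (λ y → T y v))
∑-swap {zero}  T = refl
∑-swap {suc m} T = trans (cong₂ _+_ (∑-swap (T ∘ (false ∷_))) (∑-swap (T ∘ (true ∷_))))
                         (sym (∑-+ (λ v → ∑ (λ y → T (false ∷ y) v)) (λ v → ∑ (λ y → T (true ∷ y) v))))

infix 4 _≟_
_≟_ : ∀ {n} (x y : Vec Bool n) → Dec (x ≡ y)
_≟_ = Vecₚ.≡-dec Boolₚ._≟_

∑-δ : ∀ {n} (β : Vec Bool n) c → ∑ (λ y → if does (y ≟ β) then c else +0) ≡ c
∑-δ []          c = refl
∑-δ {suc n} (false ∷ β) c = trans (cong₂ _+_ (∑-δ β c) (∑-zero {n})) (ℤₚ.+-identityʳ c)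
∑-δ {suc n} (true ∷ β)  c = trans (cong₂ _+_ (∑-zero {n}) (∑-δ β c)) (ℤₚ.+-identityˡ c)

∑-image : ∀ {m n} (U : Vec Bool m → Vec Bool n) (π : Vec Bool n → Vec Bool m) →
          (∀ v → π (U v) ≡ v) → (φ : Vec Bool n → ℤ) → (∀ y → y ≢ U (π y) → φ y ≡ +0) →
          ∑ φ ≡ ∑ (φ ∘ U)
∑-image {m} {n} U π π∘U φ φ-off = begin
  ∑ φ                       ≡⟨ ∑-cong (λ y → sym (fibre y)) ⟩
  ∑ (λ y → ∑ (δ y))         ≡⟨ ∑-swap δ ⟩
  ∑ (λ v → ∑ (λ y → δ y v)) ≡⟨ ∑-cong (λ v → ∑-δ (U v) (φ (U v))) ⟩
  ∑ (φ ∘ U)                 ∎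
  where
  open ≡-Reasoning
  δ : Vec Bool n → Vec Bool m → ℤ
  δ y v = if does (y ≟ U v) then φ (U v) else +0
  in-fibre : ∀ {y v} → y ≡ U v → π y ≡ v
  in-fibre {y} {v} y≡Uv = trans (cong π y≡Uv) (π∘U v)
  fibre : ∀ y → ∑ (δ y) ≡ φ y
  fibre y with y ≟ U (π y)
  ... | yes y≡Uπy = trans (∑-cong on-image) (∑-δ (π y) (φ y))
    where
    on-image : ∀ v → δ y v ≡ (if does (v ≟ π y) then φ y else +0)
    on-image v with v ≟ π y
    ... | yes refl = trans (cong (if_then φ (U v) else +0) (dec-true (y ≟ U v) y≡Uπy)) (cong φ (sym y≡Uπy))
    ... | no v≢πy  = cong (if_then φ (U v) else +0) (dec-false (y ≟ U v) (λ y≡Uv → v≢πy (sym (in-fibre y≡Uv))))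
  ... | no y≢Uπy = trans (∑-cong off-image) (trans (∑-zero {m}) (sym (φ-off y y≢Uπy)))
    where
    off-image : ∀ v → δ y v ≡ +0
    off-image v = cong (if_then φ (U v) else +0)
      (dec-false (y ≟ U v) (λ y≡Uv → y≢Uπy (trans y≡Uv (cong U (sym (in-fibre y≡Uv))))))

countTrue-∑ : ∀ {n} (p : Vec Bool n → Bool) → + countTrue p ≡ ∑ (𝟙 ∘ p)
countTrue-∑ {zero} p with p []
... | true  = refl
... | false = refl
countTrue-∑ {suc n} p = begin
  + countTrue p
    ≡⟨ cong (+_ ∘ length) (Listₚ.filter-++ (Boolₚ.T? ∘ p) (half false) (half true)) ⟩
  + length (keep (half false) ++ keep (half true))
    ≡⟨ cong +_ (Listₚ.length-++ (keep (half false))) ⟩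
  + length (keep (half false)) + + length (keep (half true))
    ≡⟨ cong₂ (λ a b → + a + + b) (keep-half false) (keep-half true) ⟩
  + countTrue (p ∘ (false ∷_)) + + countTrue (p ∘ (true ∷_))
    ≡⟨ cong₂ _+_ (countTrue-∑ (p ∘ (false ∷_))) (countTrue-∑ (p ∘ (true ∷_))) ⟩
  ∑ (𝟙 ∘ p) ∎
  where
  open ≡-Reasoning
  keep : List (Vec Bool (suc n)) → List (Vec Bool (suc n))
  keep = filter (Boolₚ.T? ∘ p)
  half : Bool → List (Vec Bool (suc n))
  half b = List.map (b ∷_) (allPoints n)
  keep-map : ∀ b xs → length (keep (List.map (b ∷_) xs)) ≡ length (filter (Boolₚ.T? ∘ p ∘ (b ∷_)) xs)
  keep-map b [] = refl
  keep-map b (x ∷ xs) with p (b ∷ x)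
  ... | true  = cong suc (keep-map b xs)
  ... | false = keep-map b xs
  keep-half : ∀ b → length (keep (half b)) ≡ countTrue (p ∘ (b ∷_))
  keep-half b = keep-map b (allPoints n)

-- Chow parameters as moments against affine forms

moment : ∀ {n} → BoolFun n → (Vec Bool n → ℤ) → ℤ
moment f L = ∑ (λ y → 𝟙 (f y) * L y)

data Affine {n : ℕ} : (Vec Bool n → ℤ) → Set where
  constant   : ∀ c → Affine (λ _ → c)
  coordinate : ∀ i → Affine (λ y → 𝟙 (lookup y i))
  _+ᵃ_       : ∀ {L M} → Affine L → Affine M → Affine (λ y → L y + M y)
  _*ᵃ_       : ∀ c {L} → Affine L → Affine (λ y → c * L y)
  pointwise  : ∀ {L M} → Affine L → (∀ y → L y ≡ M y) → Affine M

w-moment : ∀ {n} (f : BoolFun n) → + w f ≡ moment f (λ _ → + 1)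
w-moment f = trans (countTrue-∑ f) (∑-cong (λ y → sym (ℤₚ.*-identityʳ (𝟙 (f y)))))

wᵢ-moment : ∀ {n} (f : BoolFun n) i → + wᵢ f i ≡ moment f (λ y → 𝟙 (lookup y i))
wᵢ-moment f i = trans (countTrue-∑ (λ y → lookup y i ∧ f y)) (∑-cong (λ y → 𝟙-∧ (lookup y i) (f y)))
  where
  𝟙-∧ : ∀ a b → 𝟙 (a ∧ b) ≡ 𝟙 b * 𝟙 a
  𝟙-∧ false false = refl
  𝟙-∧ false true  = refl
  𝟙-∧ true  false = refl
  𝟙-∧ true  true  = refl

sameChowParams⇒sameMoments : ∀ {n} {f g : BoolFun n} → ChowParams f ≡ ChowParams g →
                             ∀ {L} → Affine L → moment f L ≡ moment g L
sameChowParams⇒sameMoments {n} {f} {g} same = go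
  where
  same-w : moment f (λ _ → + 1) ≡ moment g (λ _ → + 1)
  same-w = trans (sym (w-moment f)) (trans (cong (+_ ∘ proj₂) same) (w-moment g))
  same-wᵢ : ∀ i → moment f (λ y → 𝟙 (lookup y i)) ≡ moment g (λ y → 𝟙 (lookup y i))
  same-wᵢ i = trans (sym (wᵢ-moment f i))
    (trans (cong +_ (trans (sym (Vecₚ.lookup∘tabulate (wᵢ f) i))
                    (trans (cong (λ p → lookup (proj₁ p) i) same) (Vecₚ.lookup∘tabulate (wᵢ g) i))))
           (wᵢ-moment g i))
  linear : ∀ (h : BoolFun n) c L → moment h (λ y → c * L y) ≡ c * moment h L
  linear h c L = trans (∑-cong (λ y → swap (𝟙 (h y)) c (L y))) (∑-*ˡ c (λ y → 𝟙 (h y) * L y))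
    where
    swap : ∀ a c l → a * (c * l) ≡ c * (a * l)
    swap = solve-∀
  go : ∀ {L} → Affine L → moment f L ≡ moment g L
  go (constant c) = begin
    moment f (λ _ → c)           ≡⟨ ∑-cong (λ y → cong (𝟙 (f y) *_) (sym (ℤₚ.*-identityʳ c))) ⟩
    moment f (λ _ → c * + 1)     ≡⟨ linear f c (λ _ → + 1) ⟩
    c * moment f (λ _ → + 1)     ≡⟨ cong (c *_) same-w ⟩
    c * moment g (λ _ → + 1)     ≡⟨ sym (linear g c (λ _ → + 1)) ⟩
    moment g (λ _ → c * + 1)     ≡⟨ ∑-cong (λ y → cong (𝟙 (g y) *_) (ℤₚ.*-identityʳ c)) ⟩
    moment g (λ _ → c)           ∎
    where open ≡-Reasoning
  go (coordinate i) = same-wᵢ i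
  go (_+ᵃ_ {L} {M} A B) = begin
    moment f (λ y → L y + M y)   ≡⟨ additive f ⟩
    moment f L + moment f M      ≡⟨ cong₂ _+_ (go A) (go B) ⟩
    moment g L + moment g M      ≡⟨ sym (additive g) ⟩
    moment g (λ y → L y + M y)   ∎
    where
    open ≡-Reasoning
    additive : ∀ h → moment h (λ y → L y + M y) ≡ moment h L + moment h M
    additive h = trans (∑-cong (λ y → ℤₚ.*-distribˡ-+ (𝟙 (h y)) (L y) (M y)))
                       (∑-+ (λ y → 𝟙 (h y) * L y) (λ y → 𝟙 (h y) * M y))
  go (_*ᵃ_ c {L} A) = trans (linear f c L) (trans (cong (c *_) (go A)) (sym (linear g c L)))
  go (pointwise A L≗M) = trans (∑-cong (λ y → cong (𝟙 (f y) *_) (sym (L≗M y))))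
                        (trans (go A) (∑-cong (λ y → cong (𝟙 (g y) *_) (L≗M y))))

sameMoments⇒sameChowParams : ∀ {n} {f g : BoolFun n} →
  (∀ {L} → Affine L → moment f L ≡ moment g L) → ChowParams f ≡ ChowParams g
sameMoments⇒sameChowParams {f = f} {g} same = cong₂ _,_
  (Vecₚ.tabulate-cong λ i → ℤₚ.+-injective
     (trans (wᵢ-moment f i) (trans (same (coordinate i)) (sym (wᵢ-moment g i)))))
  (ℤₚ.+-injective (trans (w-moment f) (trans (same (constant (+ 1))) (sym (w-moment g)))))

ChowParams-cong : ∀ {n} {f g : BoolFun n} → f ≗f g → ChowParams f ≡ ChowParams g
ChowParams-cong f≗g = sameMoments⇒sameChowParams (λ _ → ∑-cong (λ y → cong (λ b → 𝟙 b * _) (f≗g y)))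

Chow-cong : ∀ {n} {f g : BoolFun n} → f ≗f g → Chow f → Chow g
Chow-cong f≗g chow h same y = trans (chow h (trans same (sym (ChowParams-cong f≗g))) y) (f≗g y)

-- Nested formulas are threshold functions, hence Chow

Sign : Bool → ℤ → Set
Sign true  v = + 1 ≤ v
Sign false v = v ≤ -[1+ 0 ]

Bounded : ℕ → ℤ → Set
Bounded B v = - + B ≤ v × v ≤ + B

record Threshold {n : ℕ} (f : BoolFun n) : Set where
  field
    form    : Vec Bool n → ℤ
    affine  : Affine form
    sign    : ∀ y → Sign (f y) (form y)
    bound   : ℕ
    bounded : ∀ y → Bounded bound (form y)

threshold⇒Chow : ∀ {n} {f : BoolFun n} → Threshold f → Chow f
threshold⇒Chow {f = f} T g same y = agrees (sign y) (∑-nonneg-zero (gap-nonneg ∘ sign) gap y)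
  where
  open Threshold T
  gap : ∑ (λ y → (𝟙 (f y) - 𝟙 (g y)) * form y) ≡ +0
  gap = begin
    ∑ (λ y → (𝟙 (f y) - 𝟙 (g y)) * form y)
      ≡⟨ ∑-cong (λ y → distrib (𝟙 (f y)) (𝟙 (g y)) (form y)) ⟩
    ∑ (λ y → 𝟙 (f y) * form y - 𝟙 (g y) * form y)
      ≡⟨ ∑-- (λ y → 𝟙 (f y) * form y) (λ y → 𝟙 (g y) * form y) ⟩
    moment f form - moment g form
      ≡⟨ cong (_- moment g form) (sameChowParams⇒sameMoments (sym same) affine) ⟩
    moment g form - moment g form
      ≡⟨ ℤₚ.+-inverseʳ (moment g form) ⟩
    +0 ∎
    where
    open ≡-Reasoning
    distrib : ∀ a b v → (a - b) * v ≡ a * v - b * v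
    distrib = solve-∀
  gap-nonneg : ∀ {a b v} → Sign a v → +0 ≤ (𝟙 a - 𝟙 b) * v
  gap-nonneg {true}  {true}  _   = ℤₚ.≤-refl
  gap-nonneg {true}  {false} 1≤v = subst (+0 ≤_) (sym (ℤₚ.*-identityˡ _)) (ℤₚ.≤-trans (+≤+ z≤n) 1≤v)
  gap-nonneg {false} {true}  v≤-1 =
    subst (+0 ≤_) (sym (ℤₚ.-1*i≡-i _)) (ℤₚ.neg-mono-≤ (ℤₚ.≤-trans v≤-1 (-≤+ {n = 0})))
  gap-nonneg {false} {false} _   = ℤₚ.≤-refl
  agrees : ∀ {a b v} → Sign a v → (𝟙 a - 𝟙 b) * v ≡ +0 → b ≡ a
  agrees {true}  {true}  _    _ = refl
  agrees {false} {false} _    _ = refl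
  agrees {true}  {false} 1≤v e with trans (sym (ℤₚ.*-identityˡ _)) e
  ... | refl with 1≤v
  ... | +≤+ ()
  agrees {false} {true} v≤-1 e with trans (sym (ℤₚ.neg-involutive _)) (cong -_ (trans (sym (ℤₚ.-1*i≡-i _)) e))
  ... | refl with v≤-1
  ... | ()

bounded-+ : ∀ {B C v w} → Bounded B v → Bounded C w → Bounded (B ℕ.+ C) (v + w)
bounded-+ {B} {C} {v} {w} (l , u) (l′ , u′) =
  subst (_≤ v + w) (sym (ℤₚ.neg-distrib-+ (+ B) (+ C))) (ℤₚ.+-mono-≤ l l′) , ℤₚ.+-mono-≤ u u′

bounded-neg : ∀ {B v} → Bounded B v → Bounded B (- v)
bounded-neg {B} {v} (l , u) = ℤₚ.neg-mono-≤ u , subst (- v ≤_) (ℤₚ.neg-involutive (+ B)) (ℤₚ.neg-mono-≤ l)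

bounded-weight : ∀ B b → Bounded (suc B) (+ suc B * 𝟙 b)
bounded-weight B true  = subst (Bounded (suc B)) (sym (ℤₚ.*-identityʳ (+ suc B))) (-≤+ , ℤₚ.≤-refl)
bounded-weight B false = subst (Bounded (suc B)) (sym (ℤₚ.*-zeroʳ (+ suc B))) (-≤+ , +≤+ z≤n)

∨-step : ∀ {B v} b → Bounded B v → Sign b v → ∀ ℓ → Sign (ℓ ∨ b) (v + + suc B * 𝟙 ℓ)
∨-step {B} {v} b (l , _) _ true = subst (Sign true) (cong (_+_ v) (sym (ℤₚ.*-identityʳ (+ suc B))))
  (subst (_≤ v + + suc B) (cancel (+ B)) (ℤₚ.+-monoˡ-≤ (+ suc B) l))
  where
  cancel : ∀ x → - x + (+ 1 + x) ≡ + 1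
  cancel = solve-∀
∨-step {B} {v} b _ s false =
  subst (Sign b) (sym (trans (cong (_+_ v) (ℤₚ.*-zeroʳ (+ suc B))) (ℤₚ.+-identityʳ v))) s

∧-step : ∀ {B v} b → Bounded B v → Sign b v → ∀ ℓ → Sign (ℓ ∧ b) (v - + suc B * 𝟙 (not ℓ))
∧-step {B} {v} b _ s true =
  subst (Sign b) (sym (trans (cong (_-_ v) (ℤₚ.*-zeroʳ (+ suc B))) (ℤₚ.+-identityʳ v))) s
∧-step {B} {v} b (_ , u) _ false = subst (Sign false) (cong (_-_ v) (sym (ℤₚ.*-identityʳ (+ suc B))))
  (subst (v - + suc B ≤_) (cancel (+ B)) (ℤₚ.+-monoˡ-≤ (- + suc B) u))
  where
  cancel : ∀ x → x - (+ 1 + x) ≡ -[1+ 0 ]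
  cancel = solve-∀

affine-literal : ∀ {n} c σ (i : Fin n) → Affine (λ y → c * 𝟙 (σ xor lookup y i))
affine-literal c false i = c *ᵃ coordinate i
affine-literal c true  i =
  pointwise (c *ᵃ (constant (+ 1) +ᵃ (-[1+ 0 ] *ᵃ coordinate i))) (λ y → cong (c *_) (𝟙-not (lookup y i)))
  where
  𝟙-not : ∀ x → + 1 + -[1+ 0 ] * 𝟙 x ≡ 𝟙 (not x)
  𝟙-not true  = refl
  𝟙-not false = refl

threshold-cong : ∀ {n} {f g : BoolFun n} → f ≗f g → Threshold f → Threshold g
threshold-cong f≗g T = record
  { form = form ; affine = affine ; sign = λ y → subst (λ b → Sign b (form y)) (f≗g y) (sign y)
  ; bound = bound ; bounded = bounded }
  where open Threshold T

threshold-constant : ∀ {n} b → Threshold {n} (λ _ → b)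
threshold-constant true  = record
  { form = λ _ → + 1 ; affine = constant (+ 1) ; sign = λ _ → ℤₚ.≤-refl
  ; bound = 1 ; bounded = λ _ → -≤+ , ℤₚ.≤-refl }
threshold-constant false = record
  { form = λ _ → -[1+ 0 ] ; affine = constant -[1+ 0 ] ; sign = λ _ → ℤₚ.≤-refl
  ; bound = 1 ; bounded = λ _ → ℤₚ.≤-refl , -≤+ }

threshold-∨-literal : ∀ {n} {f : BoolFun n} σ i → Threshold f →
                      Threshold (λ y → (σ xor lookup y i) ∨ f y)
threshold-∨-literal {f = f} σ i T = record
  { form    = λ y → form y + + suc bound * 𝟙 (σ xor lookup y i)
  ; affine  = affine +ᵃ affine-literal (+ suc bound) σ i
  ; sign    = λ y → ∨-step (f y) (bounded y) (sign y) (σ xor lookup y i)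
  ; bound   = bound ℕ.+ suc bound
  ; bounded = λ y → bounded-+ (bounded y) (bounded-weight bound (σ xor lookup y i)) }
  where open Threshold T

threshold-∧-literal : ∀ {n} {f : BoolFun n} σ i → Threshold f →
                      Threshold (λ y → (σ xor lookup y i) ∧ f y)
threshold-∧-literal {f = f} σ i T = record
  { form    = λ y → form y - + suc bound * 𝟙 (not (σ xor lookup y i))
  ; affine  = pointwise (affine +ᵃ (-[1+ 0 ] *ᵃ negated-literal))
                        (λ y → cong (_+_ (form y)) (ℤₚ.-1*i≡-i _))
  ; sign    = λ y → ∧-step (f y) (bounded y) (sign y) (σ xor lookup y i)
  ; bound   = bound ℕ.+ suc bound
  ; bounded = λ y → bounded-+ (bounded y)
                               (bounded-neg (bounded-weight bound (not (σ xor lookup y i)))) }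
  where
  open Threshold T
  negated-literal : Affine (λ y → + suc bound * 𝟙 (not (σ xor lookup y i)))
  negated-literal = pointwise (affine-literal (+ suc bound) (not σ) i)
    (λ y → cong (λ b → + suc bound * 𝟙 b) (sym (Boolₚ.not-distribˡ-xor σ (lookup y i))))

nested⇒threshold : ∀ {n} {φ : Formula n} → Nested φ → Threshold ⟦ φ ⟧
nested⇒threshold (pos i) = threshold-cong (λ y → Boolₚ.∨-identityʳ (lookup y i))
  (threshold-∨-literal false i (threshold-constant false))
nested⇒threshold (negl i) = threshold-cong (λ y → Boolₚ.∨-identityʳ (not (lookup y i)))
  (threshold-∨-literal true i (threshold-constant false))
nested⇒threshold (or-pos i t _)  = threshold-∨-literal false i (nested⇒threshold t)
nested⇒threshold (or-neg i t _)  = threshold-∨-literal true i (nested⇒threshold t)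
nested⇒threshold (and-pos i t _) = threshold-∧-literal false i (nested⇒threshold t)
nested⇒threshold (and-neg i t _) = threshold-∧-literal true i (nested⇒threshold t)

lro⇒Chow : ∀ {n} {f : BoolFun n} → LinearReadOnce f → Chow f
lro⇒Chow (inj₁ (b , f≡b)) = threshold⇒Chow (threshold-cong (λ y → sym (f≡b y)) (threshold-constant b))
lro⇒Chow (inj₂ (φ , φ-nested , ⟦φ⟧≗f)) =
  threshold⇒Chow (threshold-cong ⟦φ⟧≗f (nested⇒threshold φ-nested))

-- Restrictions of Chow functions are Chow

embed : ∀ {n k} → Vec Bool n → Vec (Fin n) k → Vec Bool k → Vec Bool n
embed α []       []       = α
embed α (i ∷ is) (x ∷ xs) = embed (α [ i ]≔ x) is xs

project : ∀ {n k} → Vec (Fin n) k → Vec Bool n → Vec Bool k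
project is y = Vec.map (lookup y) is

lookup-update-cong : ∀ {n} {xs ys : Vec Bool n} {j} k e →
                     lookup xs j ≡ lookup ys j → lookup (xs [ k ]≔ e) j ≡ lookup (ys [ k ]≔ e) j
lookup-update-cong {xs = xs} {ys} {j} k e p with k Finₚ.≟ j
... | yes refl = trans (Vecₚ.lookup∘update k xs e) (sym (Vecₚ.lookup∘update k ys e))
... | no k≢j   =
  trans (Vecₚ.lookup∘update′ (k≢j ∘ sym) xs e) (trans p (sym (Vecₚ.lookup∘update′ (k≢j ∘ sym) ys e)))

lookup-embed-cong : ∀ {n k} {α β : Vec Bool n} (is : Vec (Fin n) k) v {j} →
                    lookup α j ≡ lookup β j → lookup (embed α is v) j ≡ lookup (embed β is v) j
lookup-embed-cong []       []       p = p
lookup-embed-cong {α = α} {β} (i ∷ is) (x ∷ xs) p =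
  lookup-embed-cong is xs (lookup-update-cong {xs = α} {β} i x p)

lookup-embed-∉ : ∀ {n k} {α : Vec Bool n} (is : Vec (Fin n) k) v {j} →
                 j ∉ᵥ is → lookup (embed α is v) j ≡ lookup α j
lookup-embed-∉         []       []       _  = refl
lookup-embed-∉ {α = α} (i ∷ is) (x ∷ xs) j∉ =
  trans (lookup-embed-∉ is xs (j∉ ∘ Anyᵥ.there)) (Vecₚ.lookup∘update′ (j∉ ∘ Anyᵥ.here) α x)

head-∉ : ∀ {n k} {i : Fin n} {is : Vec (Fin n) k} → Uniqueᵥ (i ∷ is) → i ∉ᵥ is
head-∉ (i≢is ∷ _) i∈is = Allᵥ.lookup i≢is i∈is refl

lookup-embed-∈ : ∀ {n k} {α : Vec Bool n} {is : Vec (Fin n) k} v {j} → Uniqueᵥ is →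
                 (j∈is : j ∈ᵥ is) → lookup (embed α is v) j ≡ lookup v (Anyᵥ.index j∈is)
lookup-embed-∈ {α = α} {i ∷ is} (x ∷ xs) u (Anyᵥ.here refl) =
  trans (lookup-embed-∉ is xs (head-∉ u)) (Vecₚ.lookup∘update i α x)
lookup-embed-∈ (x ∷ xs) (_ ∷ u) (Anyᵥ.there j∈is) = lookup-embed-∈ xs u j∈is

project-embed : ∀ {n k} {α : Vec Bool n} {is : Vec (Fin n) k} v → Uniqueᵥ is →
                project is (embed α is v) ≡ v
project-embed {is = []}     []       _ = refl
project-embed {α = α} {i ∷ is} (x ∷ xs) u@(_ ∷ u′) =
  cong₂ _∷_ (trans (lookup-embed-∉ is xs (head-∉ u)) (Vecₚ.lookup∘update i α x)) (project-embed xs u′)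

affine-∘embed : ∀ {n k} (α : Vec Bool n) {is : Vec (Fin n) k} → Uniqueᵥ is →
                ∀ {L} → Affine L → Affine (λ v → L (embed α is v))
affine-∘embed α u (constant c) = constant c
affine-∘embed α {is} u (coordinate i) with Anyᵥ.any? (i Finₚ.≟_) is
... | yes i∈is = pointwise (coordinate (Anyᵥ.index i∈is)) (λ v → cong 𝟙 (sym (lookup-embed-∈ v u i∈is)))
... | no  i∉is = pointwise (constant (𝟙 (lookup α i))) (λ v → cong 𝟙 (sym (lookup-embed-∉ is v i∉is)))
affine-∘embed α u (A +ᵃ B)        = affine-∘embed α u A +ᵃ affine-∘embed α u B
affine-∘embed α u (c *ᵃ A)        = c *ᵃ affine-∘embed α u A
affine-∘embed α u (pointwise A e) = pointwise (affine-∘embed α u A) (λ v → e _)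

moment-local-change : ∀ {m n} (U : Vec Bool m → Vec Bool n) (π : Vec Bool n → Vec Bool m) →
  (∀ v → π (U v) ≡ v) → {F f : BoolFun n} → (∀ y → y ≢ U (π y) → F y ≡ f y) → ∀ L →
  moment F L ≡ moment f L + (moment (F ∘ U) (L ∘ U) - moment (f ∘ U) (L ∘ U))
moment-local-change {n = n} U π π∘U {F} {f} F≡f-off L = begin
  moment F L
    ≡⟨ ∑-cong (λ y → split (𝟙 (F y)) (𝟙 (f y)) (L y)) ⟩
  ∑ (λ y → 𝟙 (f y) * L y + Δ y)
    ≡⟨ ∑-+ (λ y → 𝟙 (f y) * L y) Δ ⟩
  moment f L + ∑ Δ
    ≡⟨ cong (_+_ (moment f L)) (∑-image U π π∘U Δ Δ-off) ⟩
  moment f L + ∑ (Δ ∘ U)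
    ≡⟨ cong (_+_ (moment f L)) (∑-cong (λ v → distrib (𝟙 (F (U v))) (𝟙 (f (U v))) (L (U v)))) ⟩
  moment f L + ∑ (λ v → 𝟙 (F (U v)) * L (U v) - 𝟙 (f (U v)) * L (U v))
    ≡⟨ cong (_+_ (moment f L)) (∑-- (λ v → 𝟙 (F (U v)) * L (U v)) (λ v → 𝟙 (f (U v)) * L (U v))) ⟩
  moment f L + (moment (F ∘ U) (L ∘ U) - moment (f ∘ U) (L ∘ U)) ∎
  where
  open ≡-Reasoning
  Δ : Vec Bool n → ℤ
  Δ y = (𝟙 (F y) - 𝟙 (f y)) * L y
  split : ∀ a b l → a * l ≡ b * l + (a - b) * l
  split = solve-∀
  distrib : ∀ a b l → (a - b) * l ≡ a * l - b * l
  distrib = solve-∀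
  Δ-off : ∀ y → y ≢ U (π y) → Δ y ≡ +0
  Δ-off y y∉U = trans (cong (λ b → (𝟙 b - 𝟙 (f y)) * L y) (F≡f-off y y∉U))
                      (cong (_* L y) (ℤₚ.+-inverseʳ (𝟙 (f y))))

restriction-Chow : ∀ {n k} {f : BoolFun n} (α : Vec Bool n) {is : Vec (Fin n) k} → Uniqueᵥ is →
                   Chow f → Chow (λ v → f (embed α is v))
restriction-Chow {n} {k} {f} α {is} u chow g same v = trans (sym (F-on v)) (chow F sameF (U v))
  where
  U : Vec Bool k → Vec Bool n
  U = embed α is
  π : Vec Bool n → Vec Bool k
  π = project is
  π∘U : ∀ v → π (U v) ≡ v
  π∘U v = project-embed v u
  F : BoolFun n
  F y = if does (y ≟ U (π y)) then g (π y) else f y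
  F-on : ∀ v → F (U v) ≡ g v
  F-on v = trans (cong (if_then g (π (U v)) else f (U v))
                       (dec-true (U v ≟ U (π (U v))) (cong U (sym (π∘U v)))))
                 (cong g (π∘U v))
  F-off : ∀ y → y ≢ U (π y) → F y ≡ f y
  F-off y y∉U = cong (if_then g (π y) else f y) (dec-false (y ≟ U (π y)) y∉U)
  moments : ∀ {L} → Affine L → moment F L ≡ moment f L
  moments {L} A = begin
    moment F L
      ≡⟨ moment-local-change U π π∘U F-off L ⟩
    moment f L + (moment (F ∘ U) (L ∘ U) - moment (f ∘ U) (L ∘ U))
      ≡⟨ cong (λ m → moment f L + (m - moment (f ∘ U) (L ∘ U))) F∘U-moment ⟩
    moment f L + (moment (f ∘ U) (L ∘ U) - moment (f ∘ U) (L ∘ U))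
      ≡⟨ cong (_+_ (moment f L)) (ℤₚ.+-inverseʳ (moment (f ∘ U) (L ∘ U))) ⟩
    moment f L + +0
      ≡⟨ ℤₚ.+-identityʳ (moment f L) ⟩
    moment f L ∎
    where
    open ≡-Reasoning
    F∘U-moment : moment (F ∘ U) (L ∘ U) ≡ moment (f ∘ U) (L ∘ U)
    F∘U-moment = trans (∑-cong (λ v → cong (λ b → 𝟙 b * L (U v)) (F-on v)))
                       (sameChowParams⇒sameMoments same (affine-∘embed α u A))
  sameF : ChowParams F ≡ ChowParams f
  sameF = sameMoments⇒sameChowParams moments

-- Forbidden restrictions are not Chow

∀-Bool? : {P : Bool → Set} → (∀ b → Dec (P b)) → Dec (∀ b → P b)
∀-Bool? P? with P? false | P? true
... | yes p₀ | yes p₁ = yes λ { false → p₀ ; true → p₁ }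
... | no ¬p₀ | _      = no λ p → ¬p₀ (p false)
... | _      | no ¬p₁ = no λ p → ¬p₁ (p true)

∀-cube? : ∀ {n} {P : Vec Bool n → Set} → (∀ y → Dec (P y)) → Dec (∀ y → P y)
∀-cube? {zero} P? with P? []
... | yes p = yes λ { [] → p }
... | no ¬p = no λ p → ¬p (p [])
∀-cube? {suc n} P? with ∀-Bool? (λ b → ∀-cube? (λ y → P? (b ∷ y)))
... | yes p = yes λ { (b ∷ y) → p b y }
... | no ¬p = no λ p → ¬p (λ b y → p (b ∷ y))

Essential : ∀ {k} → BoolFun k → Fin k → Set
Essential G i = ¬ (∀ v b → G v ≡ G (v [ i ]≔ b))

Restriction : ∀ {n k} → BoolFun n → BoolFun k → Set
Restriction {n} {k} f G =
  Σ (Vec (Fin n) k) λ is → Uniqueᵥ is × Σ (Vec Bool n) λ α → ∀ v → f (embed α is v) ≡ G v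

uncurry⁴ : (Bool → Bool → Bool → Bool → Bool) → BoolFun 4
uncurry⁴ g (x ∷ y ∷ z ∷ u ∷ []) = g x y z u

variant : (Bool → Bool → Bool → Bool → Bool) → Bool → Vec Bool 4 → BoolFun 4
variant g c s v = c xor uncurry⁴ g (Vec.zipWith _xor_ v s)

Forbidden : ∀ {n} → BoolFun n → Set
Forbidden f = Σ Bool λ c → Σ (Vec Bool 4) λ s → Restriction f (variant g₁ c s)

h₁ : Bool → Bool → Bool → Bool → Bool
h₁ x y z u = (x ∨ z) ∧ (y ∨ u)

variant-twin-params : ∀ c s → ChowParams (variant g₁ c s) ≡ ChowParams (variant h₁ c s)
variant-twin-params = from-yes (∀-Bool? λ c → ∀-cube? λ s →
  Productₚ.≡-dec (Vecₚ.≡-dec ℕₚ._≟_) ℕₚ._≟_ (ChowParams (variant g₁ c s)) (ChowParams (variant h₁ c s)))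

variant-twin-differs : ∀ c s → ¬ (variant h₁ c s ≗f variant g₁ c s)
variant-twin-differs = from-yes (∀-Bool? λ c → ∀-cube? λ s → ¬? (∀-cube? λ v →
  variant h₁ c s v Boolₚ.≟ variant g₁ c s v))

variant-essential : ∀ c s i → Essential (variant g₁ c s) i
variant-essential = from-yes (∀-Bool? λ c → ∀-cube? λ s → Finₚ.all? λ i → ¬? (∀-cube? λ v → ∀-Bool? λ b →
  variant g₁ c s v Boolₚ.≟ variant g₁ c s (v [ i ]≔ b)))

g₂-as-variant : ∀ s v → variant g₂ false s v ≡ variant g₁ true (Vec.map not s) v
g₂-as-variant = from-yes (∀-cube? λ s → ∀-cube? λ v →
  variant g₂ false s v Boolₚ.≟ variant g₁ true (Vec.map not s) v)

variant-as-g₂ : ∀ s v → variant g₁ true s v ≡ variant g₂ false (Vec.map not s) v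
variant-as-g₂ = from-yes (∀-cube? λ s → ∀-cube? λ v →
  variant g₁ true s v Boolₚ.≟ variant g₂ false (Vec.map not s) v)

Distinct⁴ : ∀ {n} → Fin n → Fin n → Fin n → Fin n → Set
Distinct⁴ a b c d = a ≢ b × a ≢ c × a ≢ d × b ≢ c × b ≢ d × c ≢ d

distinct⇒unique : ∀ {n} {a b c d : Fin n} → Distinct⁴ a b c d → Uniqueᵥ (a ∷ b ∷ c ∷ d ∷ [])
distinct⇒unique (a≢b , a≢c , a≢d , b≢c , b≢d , c≢d) =
  (a≢b ∷ a≢c ∷ a≢d ∷ []) ∷ (b≢c ∷ b≢d ∷ []) ∷ (c≢d ∷ []) ∷ [] ∷ []

unique⇒distinct : ∀ {n} {a b c d : Fin n} → Uniqueᵥ (a ∷ b ∷ c ∷ d ∷ []) → Distinct⁴ a b c d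
unique⇒distinct ((a≢b ∷ a≢c ∷ a≢d ∷ []) ∷ (b≢c ∷ b≢d ∷ []) ∷ (c≢d ∷ []) ∷ [] ∷ []) =
  a≢b , a≢c , a≢d , b≢c , b≢d , c≢d

restrictsTo⇒restriction : ∀ {n} {f : BoolFun n} {g} → RestrictsTo f g →
                          Σ (Vec Bool 4) λ s → Restriction f (variant g false s)
restrictsTo⇒restriction (a , b , c , d , distinct , α , s₁ , s₂ , s₃ , s₄ , restricts) =
  s₁ ∷ s₂ ∷ s₃ ∷ s₄ ∷ [] , a ∷ b ∷ c ∷ d ∷ [] , distinct⇒unique distinct , α ,
  λ { (x ∷ y ∷ z ∷ u ∷ []) → restricts x y z u }

restriction⇒restrictsTo : ∀ {n} {f : BoolFun n} {g} s → Restriction f (variant g false s) → RestrictsTo f g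
restriction⇒restrictsTo (s₁ ∷ s₂ ∷ s₃ ∷ s₄ ∷ []) (a ∷ b ∷ c ∷ d ∷ [] , unique , α , restricts) =
  a , b , c , d , unique⇒distinct unique , α , s₁ , s₂ , s₃ , s₄ ,
  λ x y z u → restricts (x ∷ y ∷ z ∷ u ∷ [])

restriction-cong : ∀ {n k} {f f′ : BoolFun n} {G G′ : BoolFun k} → f ≗f f′ → G ≗f G′ →
                   Restriction f G → Restriction f′ G′
restriction-cong f≗f′ G≗G′ (is , u , α , restricts) =
  is , u , α , λ v → trans (sym (f≗f′ _)) (trans (restricts v) (G≗G′ v))

forbidden⇒restrictsTo : ∀ {n} {f : BoolFun n} → Forbidden f → RestrictsTo f g₁ ⊎ RestrictsTo f g₂
forbidden⇒restrictsTo {f = f} (false , s , r) = inj₁ (restriction⇒restrictsTo {f = f} s r)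
forbidden⇒restrictsTo {f = f} (true  , s , r) =
  inj₂ (restriction⇒restrictsTo {f = f} (Vec.map not s)
                                (restriction-cong {f = f} (λ _ → refl) (variant-as-g₂ s) r))

restrictsTo⇒forbidden : ∀ {n} {f : BoolFun n} → RestrictsTo f g₁ ⊎ RestrictsTo f g₂ → Forbidden f
restrictsTo⇒forbidden {f = f} (inj₁ r₁) with restrictsTo⇒restriction {f = f} r₁
... | s , r = false , s , r
restrictsTo⇒forbidden {f = f} (inj₂ r₂) with restrictsTo⇒restriction {f = f} r₂
... | s , r = true , Vec.map not s , restriction-cong {f = f} (λ _ → refl) (g₂-as-variant s) r

variant-¬Chow : ∀ c s → ¬ Chow (variant g₁ c s)
variant-¬Chow c s chow = variant-twin-differs c s (chow (variant h₁ c s) (sym (variant-twin-params c s)))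

forbidden⇒¬Chow : ∀ {n} {f : BoolFun n} → Forbidden f → ¬ Chow f
forbidden⇒¬Chow (c , s , is , u , α , restricts) chow =
  variant-¬Chow c s (Chow-cong restricts (restriction-Chow α u chow))

Chow⇒noForbidden : ∀ {n} {f : BoolFun n} → Chow f → NoForbiddenRestriction f
Chow⇒noForbidden {f = f} chow =
  (λ r → forbidden⇒¬Chow (restrictsTo⇒forbidden {f = f} (inj₁ r)) chow) ,
  (λ r → forbidden⇒¬Chow (restrictsTo⇒forbidden {f = f} (inj₂ r)) chow)

-- Forbidden restrictions of conjunctions

DependsOnlyOn : ∀ {n} → BoolFun n → List (Fin n) → Set
DependsOnlyOn {n} f V = ∀ x y → (∀ {i} → i ∈ V → lookup x i ≡ lookup y i) → f x ≡ f y

⟦⟧-dependsOnlyOn-vars : ∀ {n} (φ : Formula n) → DependsOnlyOn ⟦ φ ⟧ (vars φ)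
⟦⟧-dependsOnlyOn-vars (const b) x y agree = refl
⟦⟧-dependsOnlyOn-vars (var i)   x y agree = agree (here refl)
⟦⟧-dependsOnlyOn-vars (neg φ)   x y agree = cong not (⟦⟧-dependsOnlyOn-vars φ x y agree)
⟦⟧-dependsOnlyOn-vars (and φ ψ) x y agree =
  cong₂ _∧_ (⟦⟧-dependsOnlyOn-vars φ x y (agree ∘ ∈-++⁺ˡ)) (⟦⟧-dependsOnlyOn-vars ψ x y (agree ∘ ∈-++⁺ʳ (vars φ)))
⟦⟧-dependsOnlyOn-vars (or φ ψ)  x y agree =
  cong₂ _∨_ (⟦⟧-dependsOnlyOn-vars φ x y (agree ∘ ∈-++⁺ˡ)) (⟦⟧-dependsOnlyOn-vars ψ x y (agree ∘ ∈-++⁺ʳ (vars φ)))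

splice : ∀ {n} → List (Fin n) → Vec Bool n → Vec Bool n → Vec Bool n
splice V α β = tabulate λ j → if does (Anyₗ.any? (j Finₚ.≟_) V) then lookup α j else lookup β j

lookup-splice-∈ : ∀ {n} {V : List (Fin n)} {α β j} → j ∈ V → lookup (splice V α β) j ≡ lookup α j
lookup-splice-∈ {V = V} {α} {β} {j} j∈V = trans (Vecₚ.lookup∘tabulate _ j)
  (cong (if_then lookup α j else lookup β j) (dec-true (Anyₗ.any? (j Finₚ.≟_) V) j∈V))

lookup-splice-∉ : ∀ {n} {V : List (Fin n)} {α β j} → j ∉ V → lookup (splice V α β) j ≡ lookup β j
lookup-splice-∉ {V = V} {α} {β} {j} j∉V = trans (Vecₚ.lookup∘tabulate _ j)
  (cong (if_then lookup α j else lookup β j) (dec-false (Anyₗ.any? (j Finₚ.≟_) V) j∉V))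

lookup-embed-update : ∀ {n k} {α : Vec Bool n} (is : Vec (Fin n) k) v i b {j} →
                      j ≢ lookup is i → lookup (embed α is v) j ≡ lookup (embed α is (v [ i ]≔ b)) j
lookup-embed-update {α = α} (k ∷ is) (x ∷ xs) Fin.zero b j≢k =
  lookup-embed-cong is xs (trans (Vecₚ.lookup∘update′ j≢k α x) (sym (Vecₚ.lookup∘update′ j≢k α b)))
lookup-embed-update (k ∷ is) (x ∷ xs) (Fin.suc i) b j≢ = lookup-embed-update is xs i b j≢

essential∈support : ∀ {n k} {f : BoolFun n} {V} {G : BoolFun k} {α is} →
                    DependsOnlyOn f V → (∀ v → f (embed α is v) ≡ G v) → ∀ {i} → Essential G i → lookup is i ∈ V
essential∈support {V = V} {is = is} dep restricts {i} essential with Anyₗ.any? (lookup is i Finₚ.≟_) V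
... | yes i∈V = i∈V
... | no  i∉V = ⊥-elim (essential λ v b → trans (sym (restricts v)) (trans
      (dep _ _ (λ j∈V → lookup-embed-update is v i b (λ { refl → i∉V j∈V }))) (restricts (v [ i ]≔ b))))

restriction-∧ : ∀ {n k} {f₁ f₂ : BoolFun n} {G : BoolFun k} {V W β} →
                DependsOnlyOn f₁ V → DependsOnlyOn f₂ W → Disjoint V W → (∀ i → Essential G i) →
                Restriction f₁ G → f₂ β ≡ true → Restriction (λ x → f₁ x ∧ f₂ x) G
restriction-∧ {G = G} {V} {W} {β} dep₁ dep₂ V#W essential (is , u , α , restricts) f₂β≡true =
  is , u , α′ , λ v → trans (cong₂ _∧_ (trans (dep₁ _ _ (on-V v)) (restricts v))
                                       (trans (dep₂ _ _ (on-W v)) f₂β≡true))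
                            (Boolₚ.∧-identityʳ (G v))
  where
  α′ : Vec Bool _
  α′ = splice V α β
  is⊆V : ∀ {j} → j ∈ᵥ is → j ∈ V
  is⊆V j∈is = subst (_∈ V) (sym (Anyᵥₚ.lookup-index j∈is))
                    (essential∈support {α = α} {is} dep₁ restricts (essential (Anyᵥ.index j∈is)))
  on-V : ∀ v {j} → j ∈ V → lookup (embed α′ is v) j ≡ lookup (embed α is v) j
  on-V v j∈V = lookup-embed-cong is v (lookup-splice-∈ {α = α} {β} j∈V)
  on-W : ∀ v {j} → j ∈ W → lookup (embed α′ is v) j ≡ lookup β j
  on-W v j∈W = trans (lookup-embed-∉ is v (λ j∈is → V#W (is⊆V j∈is , j∈W)))
                     (lookup-splice-∉ {α = α} {β} (λ j∈V → V#W (j∈V , j∈W)))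

forbidden-∧ : ∀ {n} {f₁ f₂ : BoolFun n} {V W β} → DependsOnlyOn f₁ V → DependsOnlyOn f₂ W → Disjoint V W →
              Forbidden f₁ → f₂ β ≡ true → Forbidden (λ x → f₁ x ∧ f₂ x)
forbidden-∧ dep₁ dep₂ V#W (c , s , r) f₂β≡true =
  c , s , restriction-∧ dep₁ dep₂ V#W (variant-essential c s) r f₂β≡true

forbidden-not : ∀ {n} {f : BoolFun n} → Forbidden f → Forbidden (not ∘ f)
forbidden-not (c , s , is , u , α , restricts) =
  not c , s , is , u , α , λ v → trans (cong not (restricts v)) (Boolₚ.not-distribˡ-xor c _)

∈∉⇒≢ : ∀ {n} {V : List (Fin n)} {i j} → j ∈ V → i ∉ V → j ≢ i
∈∉⇒≢ {V = V} j∈V i∉V j≡i = i∉V (subst (_∈ V) j≡i j∈V)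

lookup-update-update : ∀ {n} {i v : Fin n} (β : Vec Bool n) e y → i ≢ v →
                       lookup ((β [ i ]≔ e) [ v ]≔ y) i ≡ e
lookup-update-update {i = i} β e y i≢v =
  trans (Vecₚ.lookup∘update′ i≢v (β [ i ]≔ e) y) (Vecₚ.lookup∘update i β e)

⟦⟧-update-∉ : ∀ {n} (t : Formula n) {i} → i ∉ vars t → ∀ (β : Vec Bool n) e v y →
              ⟦ t ⟧ ((β [ i ]≔ e) [ v ]≔ y) ≡ ⟦ t ⟧ (β [ v ]≔ y)
⟦⟧-update-∉ t {i} i∉t β e v y = ⟦⟧-dependsOnlyOn-vars t _ _
  (λ j∈t → lookup-update-cong {xs = β [ i ]≔ e} {β} v y (Vecₚ.lookup∘update′ (∈∉⇒≢ j∈t i∉t) β e))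

literal-restriction : ∀ {n} {t : Formula n} → Nested t →
  Σ (Fin n) λ v → v ∈ vars t × Σ Bool λ τ → Σ (Vec Bool n) λ β → ∀ y → ⟦ t ⟧ (β [ v ]≔ y) ≡ τ xor y
literal-restriction {n} (pos i)  = i , here refl , false , Vec.replicate n false ,
  Vecₚ.lookup∘update i (Vec.replicate n false)
literal-restriction {n} (negl i) = i , here refl , true , Vec.replicate n false ,
  λ y → cong not (Vecₚ.lookup∘update i (Vec.replicate n false) y)
literal-restriction (or-pos i {t} nt i∉t) with literal-restriction nt
... | v , v∈t , τ , β , restricts = v , there v∈t , τ , β [ i ]≔ false ,
  λ y → cong₂ _∨_ (lookup-update-update β false y (∈∉⇒≢ v∈t i∉t ∘ sym))
                  (trans (⟦⟧-update-∉ t i∉t β false v y) (restricts y))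
literal-restriction (or-neg i {t} nt i∉t) with literal-restriction nt
... | v , v∈t , τ , β , restricts = v , there v∈t , τ , β [ i ]≔ true ,
  λ y → cong₂ _∨_ (cong not (lookup-update-update β true y (∈∉⇒≢ v∈t i∉t ∘ sym)))
                  (trans (⟦⟧-update-∉ t i∉t β true v y) (restricts y))
literal-restriction (and-pos i {t} nt i∉t) with literal-restriction nt
... | v , v∈t , τ , β , restricts = v , there v∈t , τ , β [ i ]≔ true ,
  λ y → cong₂ _∧_ (lookup-update-update β true y (∈∉⇒≢ v∈t i∉t ∘ sym))
                  (trans (⟦⟧-update-∉ t i∉t β true v y) (restricts y))
literal-restriction (and-neg i {t} nt i∉t) with literal-restriction nt
... | v , v∈t , τ , β , restricts = v , there v∈t , τ , β [ i ]≔ false ,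
  λ y → cong₂ _∧_ (cong not (lookup-update-update β false y (∈∉⇒≢ v∈t i∉t ∘ sym)))
                  (trans (⟦⟧-update-∉ t i∉t β false v y) (restricts y))

embed-agrees-with-update : ∀ {n k} {α β : Vec Bool n} (is : Vec (Fin n) k) w (V : List (Fin n)) {v y} →
  (∀ {j} → j ∈ V → j ≢ v → j ∉ᵥ is) → (∀ {j} → j ∈ V → lookup α j ≡ lookup β j) →
  lookup (embed α is w) v ≡ y → ∀ {j} → j ∈ V → lookup (embed α is w) j ≡ lookup (β [ v ]≔ y) j
embed-agrees-with-update {β = β} is w V {v} {y} outside α≈β at-v {j} j∈V with j Finₚ.≟ v
... | yes refl = trans at-v (sym (Vecₚ.lookup∘update j β y))
... | no  j≢v  =
  trans (lookup-embed-∉ is w (outside j∈V j≢v)) (trans (α≈β j∈V) (sym (Vecₚ.lookup∘update′ j≢v β y)))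

∉⁴ : ∀ {n} {a b c d j : Fin n} → j ≢ a → j ≢ b → j ≢ c → j ≢ d → j ∉ᵥ a ∷ b ∷ c ∷ d ∷ []
∉⁴ j≢a _ _ _ (Anyᵥ.here j≡a) = j≢a j≡a
∉⁴ _ j≢b _ _ (Anyᵥ.there (Anyᵥ.here j≡b)) = j≢b j≡b
∉⁴ _ _ j≢c _ (Anyᵥ.there (Anyᵥ.there (Anyᵥ.here j≡c))) = j≢c j≡c
∉⁴ _ _ _ j≢d (Anyᵥ.there (Anyᵥ.there (Anyᵥ.there (Anyᵥ.here j≡d)))) = j≢d j≡d

∨-literals-∧-forbidden : ∀ {n} σ₁ σ₂ (i₁ i₂ : Fin n) {t₁ t₂ : Formula n} →
  Nested t₁ → i₁ ∉ vars t₁ → Nested t₂ → i₂ ∉ vars t₂ → Disjoint (i₁ ∷ vars t₁) (i₂ ∷ vars t₂) →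
  Forbidden (λ x → ((σ₁ xor lookup x i₁) ∨ ⟦ t₁ ⟧ x) ∧ ((σ₂ xor lookup x i₂) ∨ ⟦ t₂ ⟧ x))
∨-literals-∧-forbidden σ₁ σ₂ i₁ i₂ {t₁} {t₂} nt₁ i₁∉t₁ nt₂ i₂∉t₂ disjoint
  with literal-restriction nt₁ | literal-restriction nt₂
... | v₁ , v₁∈t₁ , τ₁ , β₁ , restricts₁ | v₂ , v₂∈t₂ , τ₂ , β₂ , restricts₂ =
  false , σ₁ ∷ τ₁ ∷ σ₂ ∷ τ₂ ∷ [] , is , unique , α , λ { (x ∷ y ∷ z ∷ u ∷ []) → restricts x y z u }
  where
  apart : ∀ {j j′} → j ∈ i₁ ∷ vars t₁ → j′ ∈ i₂ ∷ vars t₂ → j ≢ j′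
  apart j∈ j′∈ refl = disjoint (j∈ , j′∈)
  is : Vec (Fin _) 4
  is = i₁ ∷ v₁ ∷ i₂ ∷ v₂ ∷ []
  unique : Uniqueᵥ is
  unique = distinct⇒unique
    ( ∈∉⇒≢ v₁∈t₁ i₁∉t₁ ∘ sym , apart (here refl) (here refl) , apart (here refl) (there v₂∈t₂)
    , apart (there v₁∈t₁) (here refl) , apart (there v₁∈t₁) (there v₂∈t₂) , ∈∉⇒≢ v₂∈t₂ i₂∉t₂ ∘ sym )
  α : Vec Bool _
  α = splice (vars t₁) β₁ β₂
  restricts : ∀ x y z u → let P = embed α is (x ∷ y ∷ z ∷ u ∷ []) in
    ((σ₁ xor lookup P i₁) ∨ ⟦ t₁ ⟧ P) ∧ ((σ₂ xor lookup P i₂) ∨ ⟦ t₂ ⟧ P)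
      ≡ g₁ (x xor σ₁) (y xor τ₁) (z xor σ₂) (u xor τ₂)
  restricts x y z u = cong₂ _∧_
    (cong₂ _∨_ (trans (cong (σ₁ xor_) (at (Anyᵥ.here refl))) (Boolₚ.xor-comm σ₁ x))
               (trans (⟦⟧-dependsOnlyOn-vars t₁ _ _ agree₁) (trans (restricts₁ y) (Boolₚ.xor-comm τ₁ y))))
    (cong₂ _∨_ (trans (cong (σ₂ xor_) (at (Anyᵥ.there (Anyᵥ.there (Anyᵥ.here refl))))) (Boolₚ.xor-comm σ₂ z))
               (trans (⟦⟧-dependsOnlyOn-vars t₂ _ _ agree₂) (trans (restricts₂ u) (Boolₚ.xor-comm τ₂ u))))
    where
    xyzu : Vec Bool 4
    xyzu = x ∷ y ∷ z ∷ u ∷ []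
    at : ∀ {j} (j∈is : j ∈ᵥ is) → lookup (embed α is xyzu) j ≡ lookup xyzu (Anyᵥ.index j∈is)
    at = lookup-embed-∈ {α = α} xyzu unique
    agree₁ : ∀ {j} → j ∈ vars t₁ → lookup (embed α is xyzu) j ≡ lookup (β₁ [ v₁ ]≔ y) j
    agree₁ = embed-agrees-with-update {α = α} {β₁} is xyzu (vars t₁)
      (λ j∈t₁ j≢v₁ → ∉⁴ (∈∉⇒≢ j∈t₁ i₁∉t₁) j≢v₁ (apart (there j∈t₁) (here refl)) (apart (there j∈t₁) (there v₂∈t₂)))
      (lookup-splice-∈ {α = β₁} {β₂}) (at (Anyᵥ.there (Anyᵥ.here refl)))
    agree₂ : ∀ {j} → j ∈ vars t₂ → lookup (embed α is xyzu) j ≡ lookup (β₂ [ v₂ ]≔ u) j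
    agree₂ = embed-agrees-with-update {α = α} {β₂} is xyzu (vars t₂)
      (λ j∈t₂ j≢v₂ → ∉⁴ (apart (here refl) (there j∈t₂) ∘ sym) (apart (there v₁∈t₁) (there j∈t₂) ∘ sym)
                        (∈∉⇒≢ j∈t₂ i₂∉t₂) j≢v₂)
      (λ j∈t₂ → lookup-splice-∉ {α = β₁} {β₂} (λ j∈t₁ → disjoint (there j∈t₁ , there j∈t₂)))
      (at (Anyᵥ.there (Anyᵥ.there (Anyᵥ.there (Anyᵥ.here refl)))))

-- Every read-once function is constant, nested, or has a forbidden restriction

lit : ∀ {n} → Bool → Fin n → Formula n
lit false i = var i
lit true  i = neg (var i)

⟦lit⟧ : ∀ {n} σ (i : Fin n) x → ⟦ lit σ i ⟧ x ≡ σ xor lookup x i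
⟦lit⟧ false i x = refl
⟦lit⟧ true  i x = refl

vars-lit : ∀ {n} σ (i : Fin n) → vars (lit σ i) ≡ i ∷ []
vars-lit false i = refl
vars-lit true  i = refl

∈-vars-lit : ∀ {n} σ {i j : Fin n} → j ∈ vars (lit σ i) → j ≡ i
∈-vars-lit false (here j≡i) = j≡i
∈-vars-lit true  (here j≡i) = j≡i

nested-lit : ∀ {n} σ (i : Fin n) → Nested (lit σ i)
nested-lit false i = pos i
nested-lit true  i = negl i

nested-∧-lit : ∀ {n} σ (i : Fin n) {t} → Nested t → i ∉ vars t → Nested (and (lit σ i) t)
nested-∧-lit false i = and-pos i
nested-∧-lit true  i = and-neg i

nested-∨-lit : ∀ {n} σ (i : Fin n) {t} → Nested t → i ∉ vars t → Nested (or (lit σ i) t)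
nested-∨-lit false i = or-pos i
nested-∨-lit true  i = or-neg i

not-∨ : ∀ a b → not (a ∨ b) ≡ not a ∧ not b
not-∨ false b = refl
not-∨ true  b = refl

not-∧ : ∀ a b → not (a ∧ b) ≡ not a ∨ not b
not-∧ false b = refl
not-∧ true  b = refl

nested-not : ∀ {n} {χ : Formula n} → Nested χ →
  Σ (Formula n) λ χ′ → Nested χ′ × (∀ x → ⟦ χ′ ⟧ x ≡ not (⟦ χ ⟧ x)) × vars χ′ ≡ vars χ
nested-not (pos i)  = neg (var i) , negl i , (λ _ → refl) , refl
nested-not (negl i) = var i , pos i , (λ x → sym (Boolₚ.not-involutive (lookup x i))) , refl
nested-not (or-pos i {t} nt i∉t) with nested-not nt
... | t′ , nt′ , ⟦t′⟧ , vars-t′ = and (neg (var i)) t′ , and-neg i nt′ (subst (i ∉_) (sym vars-t′) i∉t) ,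
  (λ x → trans (cong (not (lookup x i) ∧_) (⟦t′⟧ x)) (sym (not-∨ (lookup x i) (⟦ t ⟧ x)))) , cong (i ∷_) vars-t′
nested-not (and-pos i {t} nt i∉t) with nested-not nt
... | t′ , nt′ , ⟦t′⟧ , vars-t′ = or (neg (var i)) t′ , or-neg i nt′ (subst (i ∉_) (sym vars-t′) i∉t) ,
  (λ x → trans (cong (not (lookup x i) ∨_) (⟦t′⟧ x)) (sym (not-∧ (lookup x i) (⟦ t ⟧ x)))) , cong (i ∷_) vars-t′
nested-not (or-neg i {t} nt i∉t) with nested-not nt
... | t′ , nt′ , ⟦t′⟧ , vars-t′ = and (var i) t′ , and-pos i nt′ (subst (i ∉_) (sym vars-t′) i∉t) ,
  (λ x → trans (cong₂ _∧_ (sym (Boolₚ.not-involutive (lookup x i))) (⟦t′⟧ x))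
                (sym (not-∨ (not (lookup x i)) (⟦ t ⟧ x)))) ,
  cong (i ∷_) vars-t′
nested-not (and-neg i {t} nt i∉t) with nested-not nt
... | t′ , nt′ , ⟦t′⟧ , vars-t′ = or (var i) t′ , or-pos i nt′ (subst (i ∉_) (sym vars-t′) i∉t) ,
  (λ x → trans (cong₂ _∨_ (sym (Boolₚ.not-involutive (lookup x i))) (⟦t′⟧ x))
                (sym (not-∧ (not (lookup x i)) (⟦ t ⟧ x)))) ,
  cong (i ∷_) vars-t′

data Trichotomy {n : ℕ} (V : List (Fin n)) (f : BoolFun n) : Set where
  constant  : Constant f → Trichotomy V f
  nested    : (χ : Formula n) → Nested χ → ⟦ χ ⟧ ≗f f → vars χ ⊆ V → Trichotomy V f
  forbidden : Forbidden f → Trichotomy V f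

trichotomy-cong : ∀ {n} {V : List (Fin n)} {f g : BoolFun n} → f ≗f g → Trichotomy V f → Trichotomy V g
trichotomy-cong f≗g (constant (b , f≡b)) = constant (b , λ x → trans (sym (f≗g x)) (f≡b x))
trichotomy-cong f≗g (nested χ nχ ⟦χ⟧≗f χ⊆V) = nested χ nχ (λ x → trans (⟦χ⟧≗f x) (f≗g x)) χ⊆V
trichotomy-cong {f = f} f≗g (forbidden (c , s , r)) =
  forbidden (c , s , restriction-cong {f = f} f≗g (λ _ → refl) r)

trichotomy-⊆ : ∀ {n} {V W : List (Fin n)} {f : BoolFun n} → V ⊆ W → Trichotomy V f → Trichotomy W f
trichotomy-⊆ V⊆W (constant c)             = constant c
trichotomy-⊆ V⊆W (nested χ nχ ⟦χ⟧≗f χ⊆V) = nested χ nχ ⟦χ⟧≗f (V⊆W ∘ χ⊆V)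
trichotomy-⊆ V⊆W (forbidden fb)           = forbidden fb

trichotomy-not : ∀ {n} {V : List (Fin n)} {f : BoolFun n} → Trichotomy V f → Trichotomy V (not ∘ f)
trichotomy-not (constant (b , f≡b)) = constant (not b , cong not ∘ f≡b)
trichotomy-not (nested χ nχ ⟦χ⟧≗f χ⊆V) with nested-not nχ
... | χ′ , nχ′ , ⟦χ′⟧ , vars-χ′ =
  nested χ′ nχ′ (λ x → trans (⟦χ′⟧ x) (cong not (⟦χ⟧≗f x))) (χ⊆V ∘ subst (_ ∈_) vars-χ′)
trichotomy-not {f = f} (forbidden fb) = forbidden (forbidden-not {f = f} fb)

true-point : ∀ {n} (f : BoolFun n) → (∃ λ β → f β ≡ true) ⊎ (∀ x → f x ≡ false)
true-point {zero} f with f [] in f[]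
... | true  = inj₁ ([] , f[])
... | false = inj₂ λ { [] → f[] }
true-point {suc n} f with true-point (f ∘ (false ∷_)) | true-point (f ∘ (true ∷_))
... | inj₁ (β , fβ) | _             = inj₁ (false ∷ β , fβ)
... | inj₂ _        | inj₁ (β , fβ) = inj₁ (true ∷ β , fβ)
... | inj₂ f₀       | inj₂ f₁       = inj₂ λ { (false ∷ x) → f₀ x ; (true ∷ x) → f₁ x }

∧-forbidden : ∀ {n} {U V W : List (Fin n)} {f₁ f₂ : BoolFun n} → DependsOnlyOn f₁ V → DependsOnlyOn f₂ W →
              Disjoint V W → Forbidden f₁ → Trichotomy U (λ x → f₁ x ∧ f₂ x)
∧-forbidden {f₁ = f₁} {f₂} dep₁ dep₂ V#W fb with true-point f₂
... | inj₁ (β , f₂β≡true) = forbidden (forbidden-∧ dep₁ dep₂ V#W fb f₂β≡true)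
... | inj₂ f₂≡false       = constant (false , λ x → trans (cong (f₁ x ∧_) (f₂≡false x)) (Boolₚ.∧-zeroʳ (f₁ x)))

∧-literal : ∀ {n} σ (i : Fin n) {W} {f : BoolFun n} → DependsOnlyOn f W → i ∉ W → Trichotomy W f →
            Trichotomy (i ∷ W) (λ x → ⟦ lit σ i ⟧ x ∧ f x)
∧-literal σ i {f = f} dep i∉W (constant (false , f≡false)) =
  constant (false , λ x → trans (cong (⟦ lit σ i ⟧ x ∧_) (f≡false x)) (Boolₚ.∧-zeroʳ _))
∧-literal σ i {f = f} dep i∉W (constant (true , f≡true)) =
  nested (lit σ i) (nested-lit σ i)
         (λ x → trans (sym (Boolₚ.∧-identityʳ _)) (cong (⟦ lit σ i ⟧ x ∧_) (sym (f≡true x))))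
         (here ∘ ∈-vars-lit σ)
∧-literal σ i dep i∉W (nested χ nχ ⟦χ⟧≗f χ⊆W) =
  nested (and (lit σ i) χ) (nested-∧-lit σ i nχ (i∉W ∘ χ⊆W)) (λ x → cong (⟦ lit σ i ⟧ x ∧_) (⟦χ⟧≗f x))
         (λ j∈ → ∷⁺ (subst (_ ∈_) (cong (_++ vars χ) (vars-lit σ i)) j∈))
  where
  ∷⁺ : ∀ {j} → j ∈ i ∷ vars χ → j ∈ i ∷ _
  ∷⁺ (here j≡i)  = here j≡i
  ∷⁺ (there j∈χ) = there (χ⊆W j∈χ)
∧-literal σ i {f = f} dep i∉W (forbidden fb) =
  trichotomy-cong (λ x → Boolₚ.∧-comm (f x) (⟦ lit σ i ⟧ x))
    (∧-forbidden dep (⟦⟧-dependsOnlyOn-vars (lit σ i)) W#lit fb)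
  where
  W#lit : Disjoint _ (vars (lit σ i))
  W#lit (j∈W , j∈lit) = i∉W (subst (_∈ _) (∈-vars-lit σ j∈lit) j∈W)

∉-++ : ∀ {n} {i : Fin n} {xs ys} → i ∉ xs → i ∉ ys → i ∉ xs ++ ys
∉-++ {xs = xs} i∉xs i∉ys i∈ = [ i∉xs , i∉ys ]′ (∈-++⁻ xs i∈)

∧-literal-assoc : ∀ {n} σ (i : Fin n) (t ω : Formula n) → i ∉ vars t → i ∉ vars ω →
  Trichotomy (vars t ++ vars ω) (λ x → ⟦ t ⟧ x ∧ ⟦ ω ⟧ x) →
  Trichotomy (i ∷ vars t ++ vars ω) (λ x → (⟦ lit σ i ⟧ x ∧ ⟦ t ⟧ x) ∧ ⟦ ω ⟧ x)
∧-literal-assoc σ i t ω i∉t i∉ω T =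
  trichotomy-cong (λ x → sym (Boolₚ.∧-assoc (⟦ lit σ i ⟧ x) (⟦ t ⟧ x) (⟦ ω ⟧ x)))
    (∧-literal σ i (⟦⟧-dependsOnlyOn-vars (and t ω)) (∉-++ i∉t i∉ω) T)

∧-swap : ∀ {n} (V W : List (Fin n)) (a b : BoolFun n) →
         Trichotomy (V ++ W) (λ x → a x ∧ b x) → Trichotomy (W ++ V) (λ x → b x ∧ a x)
∧-swap V W a b T = trichotomy-cong (λ x → Boolₚ.∧-comm (a x) (b x))
                                   (trichotomy-⊆ (⊆ₚ.⊆-reflexive-↭ (↭ₚ.++-comm V W)) T)

∨-lit-vars : ∀ {n} σ (i : Fin n) t → vars (or (lit σ i) t) ≡ i ∷ vars t
∨-lit-vars σ i t = cong (_++ vars t) (vars-lit σ i)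

∨-lit-∧ : ∀ {n} σ (i : Fin n) {t χ : Formula n} → Nested t → i ∉ vars t → Nested χ →
          Disjoint (vars χ) (vars (or (lit σ i) t)) →
          Trichotomy (vars χ ++ vars (or (lit σ i) t)) (λ x → ⟦ χ ⟧ x ∧ ⟦ or (lit σ i) t ⟧ x)
∨-lit-∧ σ i nt i∉t (pos j) χ#ω =
  nested _ (and-pos j (nested-∨-lit σ i nt i∉t) (λ j∈ω → χ#ω (here refl , j∈ω))) (λ _ → refl) (λ j∈ → j∈)
∨-lit-∧ σ i nt i∉t (negl j) χ#ω =
  nested _ (and-neg j (nested-∨-lit σ i nt i∉t) (λ j∈ω → χ#ω (here refl , j∈ω))) (λ _ → refl) (λ j∈ → j∈)
∨-lit-∧ σ i {t} nt i∉t (and-pos j {t′} nt′ j∉t′) χ#ω =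
  ∧-literal-assoc false j t′ (or (lit σ i) t) j∉t′ (λ j∈ω → χ#ω (here refl , j∈ω))
    (∨-lit-∧ σ i nt i∉t nt′ (λ (p , q) → χ#ω (there p , q)))
∨-lit-∧ σ i {t} nt i∉t (and-neg j {t′} nt′ j∉t′) χ#ω =
  ∧-literal-assoc true j t′ (or (lit σ i) t) j∉t′ (λ j∈ω → χ#ω (here refl , j∈ω))
    (∨-lit-∧ σ i nt i∉t nt′ (λ (p , q) → χ#ω (there p , q)))
∨-lit-∧ σ i {t} nt i∉t (or-pos j {t′} nt′ j∉t′) χ#ω =
  trichotomy-cong (λ x → cong (λ b → (lookup x j ∨ ⟦ t′ ⟧ x) ∧ (b ∨ ⟦ t ⟧ x)) (sym (⟦lit⟧ σ i x)))
    (forbidden (∨-literals-∧-forbidden false σ j i nt′ j∉t′ nt i∉t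
                  (λ (p , q) → χ#ω (p , subst (_ ∈_) (sym (∨-lit-vars σ i t)) q))))
∨-lit-∧ σ i {t} nt i∉t (or-neg j {t′} nt′ j∉t′) χ#ω =
  trichotomy-cong (λ x → cong (λ b → (not (lookup x j) ∨ ⟦ t′ ⟧ x) ∧ (b ∨ ⟦ t ⟧ x)) (sym (⟦lit⟧ σ i x)))
    (forbidden (∨-literals-∧-forbidden true σ j i nt′ j∉t′ nt i∉t
                  (λ (p , q) → χ#ω (p , subst (_ ∈_) (sym (∨-lit-vars σ i t)) q))))

nested-∧ : ∀ {n} {χ₁ χ₂ : Formula n} → Nested χ₁ → Nested χ₂ → Disjoint (vars χ₁) (vars χ₂) →
           Trichotomy (vars χ₁ ++ vars χ₂) (λ x → ⟦ χ₁ ⟧ x ∧ ⟦ χ₂ ⟧ x)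
nested-∧ (pos i)  nχ₂ χ₁#χ₂ =
  nested _ (and-pos i nχ₂ (λ i∈ → χ₁#χ₂ (here refl , i∈))) (λ _ → refl) (λ j∈ → j∈)
nested-∧ (negl i) nχ₂ χ₁#χ₂ =
  nested _ (and-neg i nχ₂ (λ i∈ → χ₁#χ₂ (here refl , i∈))) (λ _ → refl) (λ j∈ → j∈)
nested-∧ {χ₂ = χ₂} (and-pos i {t} nt i∉t) nχ₂ χ₁#χ₂ =
  ∧-literal-assoc false i t χ₂ i∉t (λ i∈ → χ₁#χ₂ (here refl , i∈))
    (nested-∧ nt nχ₂ (λ (p , q) → χ₁#χ₂ (there p , q)))
nested-∧ {χ₂ = χ₂} (and-neg i {t} nt i∉t) nχ₂ χ₁#χ₂ =
  ∧-literal-assoc true i t χ₂ i∉t (λ i∈ → χ₁#χ₂ (here refl , i∈))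
    (nested-∧ nt nχ₂ (λ (p , q) → χ₁#χ₂ (there p , q)))
nested-∧ {χ₂ = χ₂} (or-pos i {t} nt i∉t) nχ₂ χ₁#χ₂ =
  ∧-swap (vars χ₂) _ ⟦ χ₂ ⟧ ⟦ or (var i) t ⟧ (∨-lit-∧ false i nt i∉t nχ₂ (Disjointₚ.sym χ₁#χ₂))
nested-∧ {χ₂ = χ₂} (or-neg i {t} nt i∉t) nχ₂ χ₁#χ₂ =
  ∧-swap (vars χ₂) _ ⟦ χ₂ ⟧ ⟦ or (neg (var i)) t ⟧ (∨-lit-∧ true i nt i∉t nχ₂ (Disjointₚ.sym χ₁#χ₂))

trichotomy-∧ : ∀ {n} {V W : List (Fin n)} {f₁ f₂ : BoolFun n} → DependsOnlyOn f₁ V → DependsOnlyOn f₂ W →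
               Disjoint V W → Trichotomy V f₁ → Trichotomy W f₂ → Trichotomy (V ++ W) (λ x → f₁ x ∧ f₂ x)
trichotomy-∧ {f₂ = f₂} _ _ _ (constant (false , f₁≡false)) _ =
  constant (false , λ x → cong (_∧ f₂ x) (f₁≡false x))
trichotomy-∧ {V = V} {W} {f₂ = f₂} _ _ _ (constant (true , f₁≡true)) T₂ =
  trichotomy-cong (λ x → cong (_∧ f₂ x) (sym (f₁≡true x))) (trichotomy-⊆ (⊆ₚ.xs⊆ys++xs W V) T₂)
trichotomy-∧ {f₁ = f₁} _ _ _ _ (constant (false , f₂≡false)) =
  constant (false , λ x → trans (cong (f₁ x ∧_) (f₂≡false x)) (Boolₚ.∧-zeroʳ (f₁ x)))
trichotomy-∧ {V = V} {W} {f₁ = f₁} _ _ _ T₁ (constant (true , f₂≡true)) =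
  trichotomy-cong (λ x → trans (sym (Boolₚ.∧-identityʳ (f₁ x))) (cong (f₁ x ∧_) (sym (f₂≡true x))))
                  (trichotomy-⊆ (⊆ₚ.xs⊆xs++ys V W) T₁)
trichotomy-∧ dep₁ dep₂ V#W (forbidden fb) _ = ∧-forbidden dep₁ dep₂ V#W fb
trichotomy-∧ {f₁ = f₁} {f₂} dep₁ dep₂ V#W _ (forbidden fb) =
  trichotomy-cong (λ x → Boolₚ.∧-comm (f₂ x) (f₁ x)) (∧-forbidden dep₂ dep₁ (Disjointₚ.sym V#W) fb)
trichotomy-∧ _ _ V#W (nested χ₁ nχ₁ ⟦χ₁⟧≗f₁ χ₁⊆V) (nested χ₂ nχ₂ ⟦χ₂⟧≗f₂ χ₂⊆W) =
  trichotomy-cong (λ x → cong₂ _∧_ (⟦χ₁⟧≗f₁ x) (⟦χ₂⟧≗f₂ x))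
    (trichotomy-⊆ (⊆ₚ.++⁺ χ₁⊆V χ₂⊆W) (nested-∧ nχ₁ nχ₂ (λ (p , q) → V#W (χ₁⊆V p , χ₂⊆W q))))

unique-++ : ∀ {n} (xs : List (Fin n)) {ys} → Unique (xs ++ ys) → Unique xs × Unique ys × Disjoint xs ys
unique-++ []       u = [] , u , λ ()
unique-++ (x ∷ xs) (x∉ ∷ u) with unique-++ xs u
... | u-xs , u-ys , xs#ys = Allₗₚ.++⁻ˡ xs x∉ ∷ u-xs , u-ys , x∷xs#ys
  where
  x∷xs#ys : Disjoint (x ∷ xs) _
  x∷xs#ys (here refl , x∈ys) = Allₗ.lookup x∉ (∈-++⁺ʳ xs x∈ys) refl
  x∷xs#ys (there p   , q)    = xs#ys (p , q)

readOnce-trichotomy : ∀ {n} (φ : Formula n) → ReadOnceFormula φ → Trichotomy (vars φ) ⟦ φ ⟧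
readOnce-trichotomy (const b) _ = constant (b , λ _ → refl)
readOnce-trichotomy (var i)   _ = nested (var i) (pos i) (λ _ → refl) (λ j∈ → j∈)
readOnce-trichotomy (neg φ)   u = trichotomy-not (readOnce-trichotomy φ u)
readOnce-trichotomy (and φ ψ) u with unique-++ (vars φ) u
... | u-φ , u-ψ , φ#ψ = trichotomy-∧ (⟦⟧-dependsOnlyOn-vars φ) (⟦⟧-dependsOnlyOn-vars ψ) φ#ψ
                                     (readOnce-trichotomy φ u-φ) (readOnce-trichotomy ψ u-ψ)
readOnce-trichotomy (or φ ψ)  u with unique-++ (vars φ) u
... | u-φ , u-ψ , φ#ψ = trichotomy-cong (λ x → de-Morgan (⟦ φ ⟧ x) (⟦ ψ ⟧ x))
  (trichotomy-not (trichotomy-∧ (⟦⟧-dependsOnlyOn-vars (neg φ)) (⟦⟧-dependsOnlyOn-vars (neg ψ)) φ#ψ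
                                (trichotomy-not (readOnce-trichotomy φ u-φ))
                                (trichotomy-not (readOnce-trichotomy ψ u-ψ))))
  where
  de-Morgan : ∀ a b → not (not a ∧ not b) ≡ a ∨ b
  de-Morgan false b = Boolₚ.not-involutive b
  de-Morgan true  b = refl

readOnce-noForbidden⇒lro : ∀ {n} {f : BoolFun n} → ReadOnce f → NoForbiddenRestriction f → LinearReadOnce f
readOnce-noForbidden⇒lro {f = f} (φ , u , ⟦φ⟧≗f) (¬g₁ , ¬g₂)
  with trichotomy-cong ⟦φ⟧≗f (readOnce-trichotomy φ u)
... | constant c         = inj₁ c
... | nested χ nχ ⟦χ⟧≗f _ = inj₂ (χ , nχ , ⟦χ⟧≗f)
... | forbidden fb       = ⊥-elim ([ ¬g₁ , ¬g₂ ]′ (forbidden⇒restrictsTo {f = f} fb))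

theorem7 : (n : ℕ) (f : BoolFun n) → ReadOnce f →
    (LinearReadOnce f ⇔ Chow f) × (LinearReadOnce f ⇔ NoForbiddenRestriction f)
theorem7 n f ro =
  mk⇔ lro⇒Chow (readOnce-noForbidden⇒lro ro ∘ Chow⇒noForbidden) ,
  mk⇔ (Chow⇒noForbidden ∘ lro⇒Chow) (readOnce-noForbidden⇒lro ro)
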